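{- Let $\pi\in\mathrm{PP}(m,n)$, let $\Phi(\pi)=(d_{i\ell})$ and let $\lambda=\mathrm{sh}(\pi)$. Then for all $k\in[1,m]$, $$\lambda_k=\max_{\Pi:(k,1)\to(m,n)}\sum_{(i,\ell)\in\Pi}d_{i\ell},$$ where the maximum is over directed lattice paths $\Pi$ from $(k,1)$ to $(m,n)$ using only steps $(i,\ell)\to(i+1,\ell)$ and $(i,\ell)\to(i,\ell+1)$.
   Context: A plane partition is a matrix $\pi=(\pi_{ij})_{i,j\ge1}$ of nonnegative integers with finitely many nonzero entries, weakly decreasing along rows and down columns. Its shape $\mathrm{sh}(\pi)$ is the partition $\lambda$ whose $k$-th part $\lambda_k$ is the number of positive entries in row $k$. $\mathrm{PP}(m,n)$ denotes the set of plane partitions with at most $m$ nonzero rows and largest entry at most $n$. For a plane partition $\pi$, $d_{i\ell}:=|\{j:\pi_{ij}=\ell>\pi_{i+1,j}\}|$ for $i,\ell\ge1$, and $\Phi(\pi):=(d_{i\ell})$. -}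

module Defs where

open import Data.Nat using (ℕ; zero; suc; _+_; _≤_; _<_; _<ᵇ_; _≡ᵇ_)
open import Data.Bool using (Bool; true; false; if_then_else_; _∧_)
open import Relation.Binary.PropositionalEquality using (_≡_)

-- A matrix of naturals, indexed by (i , j) with i , j ≥ 1 (1-based, as in the
-- paper); the values at index 0 are ignored.
Matrix : Set
Matrix = ℕ → ℕ → ℕ

Decreasing : Matrix → Set
Decreasing π = ∀ i j → 1 ≤ i → 1 ≤ j →
  (π i (suc j) ≤ π i j) × (π (suc i) j ≤ π i j)
  where open import Data.Product using (_×_)

-- π ∈ PP(m,n), with a witness N such that every entry in a column j > N is 0
-- (i.e. every row has at most N positive entries; together with the row bound
-- this gives finitely many nonzero entries).
record IsPP (m n N : ℕ) (π : Matrix) : Set where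
  field
    decreasing : Decreasing π
    colBound   : ∀ i j → N < j → π i j ≡ 0
    rowBound   : ∀ i j → m < i → π i j ≡ 0
    entryBound : ∀ i j → 1 ≤ i → 1 ≤ j → π i j ≤ n

count : ℕ → (ℕ → Bool) → ℕ
count zero    f = 0
count (suc N) f = (if f (suc N) then 1 else 0) + count N f

-- λ_k = number of positive entries in row k (columns beyond N are all 0).
sh : ℕ → Matrix → ℕ → ℕ
sh N π k = count N (λ j → 0 <ᵇ π k j)

d : ℕ → Matrix → ℕ → ℕ → ℕ
d N π i ℓ = count N (λ j → (π i j ≡ᵇ ℓ) ∧ (π (suc i) j <ᵇ ℓ))

data Path : ℕ → ℕ → ℕ → ℕ → Set where
  stop  : ∀ {i ℓ} → Path i ℓ i ℓ
  down  : ∀ {i ℓ i' ℓ'} → Path (suc i) ℓ i' ℓ' → Path i ℓ i' ℓ'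
  right : ∀ {i ℓ i' ℓ'} → Path i (suc ℓ) i' ℓ' → Path i ℓ i' ℓ'

pathSum : (ℕ → ℕ → ℕ) → ∀ {i ℓ i' ℓ'} → Path i ℓ i' ℓ' → ℕ
pathSum w {i} {ℓ} stop      = w i ℓ
pathSum w {i} {ℓ} (down p)  = w i ℓ + pathSum w p
pathSum w {i} {ℓ} (right p) = w i ℓ + pathSum w p

IsMaxPathSum : (ℕ → ℕ → ℕ) → ℕ → ℕ → ℕ → ℕ → ℕ → Set
IsMaxPathSum w a b c e x =
  (Σ (Path a b c e) (λ p → pathSum w p ≡ x)) × (∀ (p : Path a b c e) → pathSum w p ≤ x)
  where open import Data.Product using (_×_; Σ)

-- Write A(i,ℓ) = |{j : π_ij ≥ ℓ}|, so that λ_k = A(k,1). A column counted by d_{iℓ} has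
-- π_ij = ℓ > π_{i+1,j}, so it is counted by A(i,ℓ) but by neither A(i+1,ℓ) nor A(i,ℓ+1);
-- hence d_{iℓ} + A(i+1,ℓ) ≤ A(i,ℓ) and d_{iℓ} + A(i,ℓ+1) ≤ A(i,ℓ), and telescoping along
-- any path bounds its weight by λ_k. Conversely, at every vertex one of the two inequalities
-- is an equality (their obstructions cannot coexist, as rows decrease), and on the last row
-- and column the available step is always tight because row m+1 vanishes and entries are
-- at most n; following tight steps from (k,1) gives a path of weight exactly λ_k.
module Submission where

open import Defs
open import Data.Nat using (ℕ; zero; suc; _+_; _≤_; _<_; _≤ᵇ_; _≡ᵇ_; _<ᵇ_; _≤‴_; ≤‴-refl; ≤‴-step; z≤n; s≤s)
open import Data.Nat.Properties
open import Data.Bool using (Bool; true; false; T; _∧_; _∨_; if_then_else_)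
open import Data.Bool.Properties using (T-∧; T-∨)
open import Data.Product using (_,_; proj₁; proj₂; Σ)
open import Data.Sum using (_⊎_; inj₁; inj₂; [_,_]′)
open import Data.Empty using (⊥; ⊥-elim)
open import Data.Unit using (tt)
open import Function using (_∘_)
open import Relation.Nullary using (¬_; yes; no)
open import Relation.Nullary.Decidable using (decidable-stable)
open import Relation.Binary.PropositionalEquality
  using (_≡_; refl; sym; trans; cong; cong₂; subst; module ≡-Reasoning)
open import Function.Bundles using (Equivalence)
open import Algebra.Properties.CommutativeSemigroup +-commutativeSemigroup using (interchange)

open Equivalence using (to; from)

indicator-mono : ∀ {a b} → (T a → T b) → (if a then 1 else 0) ≤ (if b then 1 else 0)
indicator-mono {false}          _   = z≤n
indicator-mono {true}  {true}   _   = ≤-refl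
indicator-mono {true}  {false} a⇒b = ⊥-elim (a⇒b tt)

indicator-∨ : ∀ {a b} → (T a → T b → ⊥) →
  (if a then 1 else 0) + (if b then 1 else 0) ≡ (if a ∨ b then 1 else 0)
indicator-∨ {true}  {true}  disj = ⊥-elim (disj tt tt)
indicator-∨ {true}  {false} _    = refl
indicator-∨ {false} {_}     _    = refl

count-mono : ∀ N {f g : ℕ → Bool} → (∀ {j} → 1 ≤ j → T (f j) → T (g j)) →
  count N f ≤ count N g
count-mono zero    _   = z≤n
count-mono (suc N) f⇒g = +-mono-≤ (indicator-mono (f⇒g (s≤s z≤n))) (count-mono N f⇒g)

count-false : ∀ N → count N (λ _ → false) ≡ 0
count-false zero    = refl
count-false (suc N) = count-false N

count-none : ∀ N {f : ℕ → Bool} → (∀ {j} → 1 ≤ j → ¬ T (f j)) → count N f ≡ 0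
count-none N none =
  n≤0⇒n≡0 (≤-trans (count-mono N (λ j≥1 → ⊥-elim ∘ none j≥1)) (≤-reflexive (count-false N)))

count-∨ : ∀ N {f g : ℕ → Bool} → (∀ {j} → 1 ≤ j → T (f j) → T (g j) → ⊥) →
  count N f + count N g ≡ count N (λ j → f j ∨ g j)
count-∨ zero    _    = refl
count-∨ (suc N) {f} {g} disj =
  trans (interchange (if f (suc N) then 1 else 0) (count N f) (if g (suc N) then 1 else 0) (count N g))
        (cong₂ _+_ (indicator-∨ (disj (s≤s z≤n))) (count-∨ N disj))

module _ (N : ℕ) {f g h : ℕ → Bool} (disjoint : ∀ {j} → 1 ≤ j → T (f j) → T (g j) → ⊥) where

  count-disjoint-≤ : (∀ {j} → 1 ≤ j → T (f j) ⊎ T (g j) → T (h j)) →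
    count N f + count N g ≤ count N h
  count-disjoint-≤ sub =
    ≤-trans (≤-reflexive (count-∨ N disjoint)) (count-mono N λ j≥1 → sub j≥1 ∘ to T-∨)

  count-disjoint-≡ : (∀ {j} → 1 ≤ j → T (f j) ⊎ T (g j) → T (h j)) →
    (∀ {j} → 1 ≤ j → T (h j) → T (f j) ⊎ T (g j)) → count N f + count N g ≡ count N h
  count-disjoint-≡ sub cover = ≤-antisym (count-disjoint-≤ sub)
    (≤-trans (count-mono N λ j≥1 → from T-∨ ∘ cover j≥1) (≤-reflexive (sym (count-∨ N disjoint))))

module LatticePaths (w V : ℕ → ℕ → ℕ) where

  DownTight RightTight : ℕ → ℕ → Set
  DownTight  i ℓ = w i ℓ + V (suc i) ℓ ≡ V i ℓ
  RightTight i ℓ = w i ℓ + V i (suc ℓ) ≡ V i ℓ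

  pathSum-≤ : ∀ {r} → (∀ {i ℓ} → r ≤ i → w i ℓ + V (suc i) ℓ ≤ V i ℓ) →
    (∀ {i ℓ} → r ≤ i → w i ℓ + V i (suc ℓ) ≤ V i ℓ) →
    ∀ {i ℓ c e} → r ≤ i → (p : Path i ℓ c e) → pathSum w p ≤ V i ℓ
  pathSum-≤ down≤ right≤ r≤i stop      = ≤-trans (m≤m+n _ _) (down≤ r≤i)
  pathSum-≤ down≤ right≤ r≤i (down p)  =
    ≤-trans (+-monoʳ-≤ _ (pathSum-≤ down≤ right≤ (m≤n⇒m≤1+n r≤i) p)) (down≤ r≤i)
  pathSum-≤ down≤ right≤ r≤i (right p) =
    ≤-trans (+-monoʳ-≤ _ (pathSum-≤ down≤ right≤ r≤i p)) (right≤ r≤i)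

  tightPath : ∀ {r s c e} → w c e ≡ V c e →
    (∀ {ℓ} → s ≤ ℓ → RightTight c ℓ) → (∀ {i} → r ≤ i → DownTight i e) →
    (∀ {i ℓ} → r ≤ i → s ≤ ℓ → DownTight i ℓ ⊎ RightTight i ℓ) →
    ∀ {i ℓ} → r ≤ i → s ≤ ℓ → i ≤‴ c → ℓ ≤‴ e → Σ (Path i ℓ c e) (λ p → pathSum w p ≡ V i ℓ)
  tightPath corner lastRow lastCol inner r≤i s≤ℓ ≤‴-refl ≤‴-refl = stop , corner
  tightPath corner lastRow lastCol inner r≤i s≤ℓ ≤‴-refl (≤‴-step ℓ<e) =
    let p , sum = tightPath corner lastRow lastCol inner r≤i (m≤n⇒m≤1+n s≤ℓ) ≤‴-refl ℓ<e
    in right p , trans (cong (w _ _ +_) sum) (lastRow s≤ℓ)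
  tightPath corner lastRow lastCol inner r≤i s≤ℓ (≤‴-step i<c) ≤‴-refl =
    let p , sum = tightPath corner lastRow lastCol inner (m≤n⇒m≤1+n r≤i) s≤ℓ i<c ≤‴-refl
    in down p , trans (cong (w _ _ +_) sum) (lastCol r≤i)
  tightPath corner lastRow lastCol inner r≤i s≤ℓ (≤‴-step i<c) (≤‴-step ℓ<e)
    with inner r≤i s≤ℓ
  ... | inj₁ downTight =
    let p , sum = tightPath corner lastRow lastCol inner (m≤n⇒m≤1+n r≤i) s≤ℓ i<c (≤‴-step ℓ<e)
    in down p , trans (cong (w _ _ +_) sum) downTight
  ... | inj₂ rightTight =
    let p , sum = tightPath corner lastRow lastCol inner r≤i (m≤n⇒m≤1+n s≤ℓ) (≤‴-step i<c) ℓ<e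
    in right p , trans (cong (w _ _ +_) sum) rightTight

atLeast : ℕ → Matrix → ℕ → ℕ → ℕ
atLeast N π i ℓ = count N (λ j → ℓ ≤ᵇ π i j)

descent-intro : ∀ {x y ℓ} → x ≡ ℓ → y < ℓ → T ((x ≡ᵇ ℓ) ∧ (y <ᵇ ℓ))
descent-intro {x} {y} {ℓ} x≡ℓ y<ℓ = from T-∧ (≡⇒≡ᵇ x ℓ x≡ℓ , <⇒<ᵇ y<ℓ)

module Descent (x y ℓ : ℕ) where

  descent-≡ : T ((x ≡ᵇ ℓ) ∧ (y <ᵇ ℓ)) → x ≡ ℓ
  descent-≡ t = ≡ᵇ⇒≡ x ℓ (proj₁ (to T-∧ t))

  descent-< : T ((x ≡ᵇ ℓ) ∧ (y <ᵇ ℓ)) → y < ℓ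
  descent-< t = <ᵇ⇒< y ℓ (proj₂ (to T-∧ t))

  descent-atLeast : T ((x ≡ᵇ ℓ) ∧ (y <ᵇ ℓ)) → T (ℓ ≤ᵇ x)
  descent-atLeast t = ≤⇒≤ᵇ (≤-reflexive (sym (descent-≡ t)))

module LevelCounts (N : ℕ) (π : Matrix) where

  open LatticePaths (d N π) (atLeast N π) public

  private
    next-disjoint : ∀ {i ℓ j} → T ((π i j ≡ᵇ ℓ) ∧ (π (suc i) j <ᵇ ℓ)) → ¬ T (suc ℓ ≤ᵇ π i j)
    next-disjoint {i} {ℓ} {j} t u = <⇒≢ (≤ᵇ⇒≤ (suc ℓ) (π i j) u) (sym (descent-≡ t))
      where open Descent (π i j) (π (suc i) j) ℓ

    next-sub : ∀ {i ℓ j} → T ((π i j ≡ᵇ ℓ) ∧ (π (suc i) j <ᵇ ℓ)) ⊎ T (suc ℓ ≤ᵇ π i j) → T (ℓ ≤ᵇ π i j)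
    next-sub {i} {ℓ} {j} = [ descent-atLeast , (λ u → ≤⇒≤ᵇ (<⇒≤ (≤ᵇ⇒≤ (suc ℓ) (π i j) u))) ]′
      where open Descent (π i j) (π (suc i) j) ℓ

  d+atLeast-next-≤ : ∀ {i ℓ} → d N π i ℓ + atLeast N π i (suc ℓ) ≤ atLeast N π i ℓ
  d+atLeast-next-≤ = count-disjoint-≤ N (λ _ → next-disjoint) (λ _ → next-sub)

  d+atLeast-next-≡ : ∀ {i ℓ} → (∀ {j} → 1 ≤ j → π i j ≡ ℓ → π (suc i) j < ℓ) → RightTight i ℓ
  d+atLeast-next-≡ {i} {ℓ} descends = count-disjoint-≡ N (λ _ → next-disjoint) (λ _ → next-sub) cover
    where
    cover : ∀ {j} → 1 ≤ j → T (ℓ ≤ᵇ π i j) → _ ⊎ T (suc ℓ ≤ᵇ π i j)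
    cover {j} j≥1 u with ℓ <? π i j
    ... | yes ℓ<πij = inj₂ (≤⇒≤ᵇ ℓ<πij)
    ... | no  ℓ≮πij = let πij≡ℓ = ≤-antisym (≮⇒≥ ℓ≮πij) (≤ᵇ⇒≤ ℓ (π i j) u)
                      in inj₁ (descent-intro πij≡ℓ (descends j≥1 πij≡ℓ))

  module _ (decreasing : Decreasing π) where

    column-antitone : ∀ {i j} → 1 ≤ i → 1 ≤ j → π (suc i) j ≤ π i j
    column-antitone {i} {j} i≥1 j≥1 = proj₂ (decreasing i j i≥1 j≥1)

    row-antitone : ∀ {i j j'} → 1 ≤ i → 1 ≤ j → j ≤ j' → π i j' ≤ π i j
    row-antitone {i} i≥1 j≥1 j≤j' = go j≥1 (≤⇒≤‴ j≤j')
      where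
      go : ∀ {j j'} → 1 ≤ j → j ≤‴ j' → π i j' ≤ π i j
      go         _   ≤‴-refl        = ≤-refl
      go {j} j≥1 (≤‴-step j<j') = ≤-trans (go (s≤s z≤n) j<j') (proj₁ (decreasing i j i≥1 j≥1))

    private
      below-disjoint : ∀ {i ℓ j} → T ((π i j ≡ᵇ ℓ) ∧ (π (suc i) j <ᵇ ℓ)) → ¬ T (ℓ ≤ᵇ π (suc i) j)
      below-disjoint {i} {ℓ} {j} t u = <⇒≱ (descent-< t) (≤ᵇ⇒≤ ℓ (π (suc i) j) u)
        where open Descent (π i j) (π (suc i) j) ℓ

      below-sub : ∀ {i ℓ j} → 1 ≤ i → 1 ≤ j →
        T ((π i j ≡ᵇ ℓ) ∧ (π (suc i) j <ᵇ ℓ)) ⊎ T (ℓ ≤ᵇ π (suc i) j) → T (ℓ ≤ᵇ π i j)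
      below-sub {i} {ℓ} {j} i≥1 j≥1 =
        [ descent-atLeast , (λ u → ≤⇒≤ᵇ (≤-trans (≤ᵇ⇒≤ ℓ (π (suc i) j) u) (column-antitone i≥1 j≥1))) ]′
        where open Descent (π i j) (π (suc i) j) ℓ

    d+atLeast-below-≤ : ∀ {i ℓ} → 1 ≤ i → d N π i ℓ + atLeast N π (suc i) ℓ ≤ atLeast N π i ℓ
    d+atLeast-below-≤ i≥1 = count-disjoint-≤ N (λ _ → below-disjoint) (below-sub i≥1)

    d+atLeast-below-≡ : ∀ {i ℓ} → 1 ≤ i → (∀ {j} → 1 ≤ j → π (suc i) j < ℓ → π i j ≤ ℓ) → DownTight i ℓ
    d+atLeast-below-≡ {i} {ℓ} i≥1 bounded =
      count-disjoint-≡ N (λ _ → below-disjoint) (below-sub i≥1) cover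
      where
      cover : ∀ {j} → 1 ≤ j → T (ℓ ≤ᵇ π i j) → _ ⊎ T (ℓ ≤ᵇ π (suc i) j)
      cover {j} j≥1 u with ℓ ≤? π (suc i) j
      ... | yes ℓ≤ = inj₂ (≤⇒≤ᵇ ℓ≤)
      ... | no  ℓ≰ = let below = ≰⇒> ℓ≰
                     in inj₁ (descent-intro (≤-antisym (bounded j≥1 below) (≤ᵇ⇒≤ ℓ (π i j) u)) below)

    no-crossing : ∀ {i ℓ j j'} → 1 ≤ i → 1 ≤ j → 1 ≤ j' → π i j ≡ ℓ → ℓ ≤ π (suc i) j →
      π (suc i) j' < ℓ → π i j' ≤ ℓ
    no-crossing {j = j} {j'} i≥1 j≥1 j'≥1 πij≡ℓ ℓ≤ below with ≤-total j j'
    ... | inj₁ j≤j' = ≤-trans (row-antitone i≥1 j≥1 j≤j') (≤-reflexive πij≡ℓ)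
    ... | inj₂ j'≤j = ⊥-elim (<⇒≱ below (≤-trans ℓ≤ (row-antitone (s≤s z≤n) j'≥1 j'≤j)))

    -- A column with π i j = ℓ ≤ π (i+1) j (obstructing right-tightness) makes down-tightness
    -- hold by no-crossing; so if right-tightness fails, down-tightness cannot fail, and
    -- equality of naturals is stable under double negation.
    downTight⊎rightTight : ∀ {i ℓ} → 1 ≤ i → DownTight i ℓ ⊎ RightTight i ℓ
    downTight⊎rightTight {i} {ℓ} i≥1 with d N π i ℓ + atLeast N π i (suc ℓ) ≟ atLeast N π i ℓ
    ... | yes rightTight = inj₂ rightTight
    ... | no ¬rightTight = inj₁ (decidable-stable (_ ≟ _) λ ¬downTight →
      ¬rightTight (d+atLeast-next-≡ λ j≥1 πij≡ℓ → ≰⇒> λ ℓ≤ →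
        ¬downTight (d+atLeast-below-≡ i≥1 (λ j'≥1 → no-crossing i≥1 j≥1 j'≥1 πij≡ℓ ℓ≤))))

  module _ {m n : ℕ} (pp : IsPP m n N π) where
    open IsPP pp

    lastRow-rightTight : ∀ {ℓ} → 1 ≤ ℓ → RightTight m ℓ
    lastRow-rightTight {ℓ} ℓ≥1 =
      d+atLeast-next-≡ λ {j} _ _ → subst (_< ℓ) (sym (rowBound (suc m) j ≤-refl)) ℓ≥1

    lastColumn-downTight : ∀ {i} → 1 ≤ i → DownTight i n
    lastColumn-downTight {i} i≥1 = d+atLeast-below-≡ decreasing i≥1 λ {j} j≥1 _ → entryBound i j i≥1 j≥1

    atLeast-above-bound : ∀ {i} → 1 ≤ i → atLeast N π i (suc n) ≡ 0
    atLeast-above-bound {i} i≥1 =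
      count-none N λ {j} j≥1 u → <⇒≱ (≤ᵇ⇒≤ (suc n) (π i j) u) (entryBound i j i≥1 j≥1)

    corner-tight : 1 ≤ m → 1 ≤ n → d N π m n ≡ atLeast N π m n
    corner-tight m≥1 n≥1 = begin
      d N π m n                              ≡⟨ +-identityʳ _ ⟨
      d N π m n + 0                          ≡⟨ cong (d N π m n +_) (atLeast-above-bound m≥1) ⟨
      d N π m n + atLeast N π m (suc n)      ≡⟨ lastRow-rightTight n≥1 ⟩
      atLeast N π m n                        ∎
      where open ≡-Reasoning

lemma2p2 : ∀ (m n N : ℕ) (π : Matrix) → 1 ≤ n → IsPP m n N π →
    ∀ (k : ℕ) → 1 ≤ k → k ≤ m →
    IsMaxPathSum (d N π) k 1 m n (sh N π k)
lemma2p2 m n N π n≥1 pp k k≥1 k≤m = maximalPath , pathSum-bounded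
  where
  open LevelCounts N π
  open IsPP pp using (decreasing)

  -- atLeast N π k 1 and sh N π k agree definitionally, as 1 ≤ᵇ x reduces to 0 <ᵇ x.
  maximalPath : Σ (Path k 1 m n) (λ p → pathSum (d N π) p ≡ atLeast N π k 1)
  maximalPath = tightPath (corner-tight pp (≤-trans k≥1 k≤m) n≥1)
    (lastRow-rightTight pp) (lastColumn-downTight pp) (λ i≥1 _ → downTight⊎rightTight decreasing i≥1)
    k≥1 ≤-refl (≤⇒≤‴ k≤m) (≤⇒≤‴ n≥1)

  pathSum-bounded : (p : Path k 1 m n) → pathSum (d N π) p ≤ atLeast N π k 1
  pathSum-bounded = pathSum-≤ (d+atLeast-below-≤ decreasing) (λ _ → d+atLeast-next-≤) k≥1
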